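{- Let $L\subseteq\mathbf{Z}_2^n$ be a linear binary code. The prechromotopology $I^n_c/L$ admits an odd dashing if and only if $L$ is a dashing code.
   Context: A code is a $\mathbf{Z}_2$-subspace of $\mathbf{Z}_2^n$; $\mathrm{wt}(w)$ is the number of $1$'s of $w$ and $w_1\cdot w_2$ the dot product in $\mathbf{Z}_2^n$. $L$ is a dashing code if every $w\in L$ has $\mathrm{wt}(w)\equiv 0$ or $1 \pmod 4$, and for all $w_1,w_2\in L$, $(w_1\cdot w_2)+\mathrm{wt}(w_1)\mathrm{wt}(w_2)\equiv 0\pmod 2$. With $e_i$ the $i$-th standard basis vector, $I^n_c/L$ is the edge-colored multigraph with vertex set $\mathbf{Z}_2^n/L$ having, for each coset $C$ and color $i\in[n]$, an edge of color $i$ joining $C$ and $C+e_i$ (one per unordered pair and color; a loop if $e_i\in L$). For a vertex $v$ let $q_i(v)$ be the other endpoint of its color-$i$ edge ($v$ itself for a loop). An odd dashing is a map $d\colon E\to\mathbf{Z}_2$ such that for every vertex $v$ and distinct colors $i,j$, the four edges traversed by the closed walk $v\to q_i(v)\to q_jq_i(v)\to q_iq_jq_i(v)=q_j(v)\to v$ (of colors $i,j,i,j$) have $d$-values summing to $1$ in $\mathbf{Z}_2$, counted with multiplicity. Equivalently, the linear maps $\overline{q}_i$ on $\mathbf{R}[V]$ given by $\overline{q}_i(v)=(-1)^{d(e)}q_i(v)$, $e$ the color-$i$ edge at $v$, pairwise anticommute. -}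

module Defs where

open import Data.Nat using (ℕ; zero; suc; _+_; _*_; _%_)
open import Data.Bool using (Bool; true; false; _xor_; _∧_; if_then_else_)
open import Data.Fin using (Fin)
open import Data.Fin.Properties using (_≟_)
open import Data.Vec using (Vec; []; _∷_; zipWith; replicate; tabulate)
open import Data.Sum using (_⊎_)
open import Data.Product using (_×_; Σ)
open import Relation.Binary.PropositionalEquality using (_≡_; _≢_)
open import Relation.Nullary.Decidable using (does)

Word : ℕ → Set
Word n = Vec Bool n

_⊕_ : ∀ {n} → Word n → Word n → Word n
_⊕_ = zipWith _xor_

𝟎 : ∀ n → Word n
𝟎 n = replicate n false

e : ∀ {n} → Fin n → Word n
e i = tabulate (λ j → does (i ≟ j))

wt : ∀ {n} → Word n → ℕ
wt [] = 0
wt (true ∷ w) = suc (wt w)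
wt (false ∷ w) = wt w

-- Number of common 1's (the dot product in Z_2 is this value mod 2).
common : ∀ {n} → Word n → Word n → ℕ
common v w = wt (zipWith _∧_ v w)

record Code (n : ℕ) : Set where
  field
    mem     : Word n → Bool
    mem-𝟎   : mem (𝟎 n) ≡ true
    mem-⊕   : ∀ v w → mem v ≡ true → mem w ≡ true → mem (v ⊕ w) ≡ true
open Code public

_∈C_ : ∀ {n} → Word n → Code n → Set
w ∈C L = mem L w ≡ true

IsDashingCode : ∀ {n} → Code n → Set
IsDashingCode L =
  (∀ w → w ∈C L → (wt w % 4 ≡ 0 ⊎ wt w % 4 ≡ 1)) ×
  (∀ w₁ w₂ → w₁ ∈C L → w₂ ∈C L → (common w₁ w₂ + wt w₁ * wt w₂) % 2 ≡ 0)

-- The edge set is the quotient of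
-- (Z_2^n/L) × [n] identifying (C , i) with (C + e_i , i); so a map
-- E → Z_2 is the same as a map  d : Z_2^n × [n] → Z_2  that is
-- constant on cosets of L and satisfies d (v + e_i) i = d v i.
-- d v i is the value on the color-i edge at the vertex v + L.
record EdgeFunction {n} (L : Code n) : Set where
  field
    val       : Word n → Fin n → Bool
    coset-inv : ∀ v w i → (v ⊕ w) ∈C L → val v i ≡ val w i
    edge-inv  : ∀ v i → val (v ⊕ e i) i ≡ val v i
open EdgeFunction public

-- Odd dashing: around every (i,j)-square v → q_i v → q_j q_i v → q_j v → v
-- the four d-values sum to 1 in Z_2.
IsOddDashing : ∀ {n} {L : Code n} → EdgeFunction L → Set
IsOddDashing {n} d =
  ∀ (v : Word n) (i j : Fin n) → i ≢ j →
    (val d v i xor val d (v ⊕ e i) j xor val d ((v ⊕ e i) ⊕ e j) i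
       xor val d (v ⊕ e j) j) ≡ true

HasOddDashing : ∀ {n} → Code n → Set
HasOddDashing L = Σ (EdgeFunction L) IsOddDashing

-- Both conditions on L say that the form β x y = Σ_{i<j} y_i x_j over 𝔽₂ is
-- alternating on L: β x x is the parity of C(wt x, 2), and β x y + β y x that of
-- x·y + wt x wt y.  An odd dashing d forces this.  Summing d along the walk that
-- crosses the colours of x twice, in order, and sorting the colours with the
-- square condition, gives β x x; for x ∈ L that walk is one closed walk of the
-- quotient traversed twice, so the sum vanishes.  Conversely, a form alternating
-- on L has a quadratic refinement on L, which extends to g on all words with
-- g (v + x) = g v + g x + β v x for x ∈ L.  The standard sign β (e i) v of the
-- cube, corrected by the coboundary of g, is then constant on cosets of L and
-- still odd around every square.

module Submission where

open import Defs
open import Data.Nat using (ℕ; zero; suc; _+_; _*_; _%_)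
open import Data.Bool using (Bool; true; false; _xor_; _∧_; _∨_; not; if_then_else_)
open import Data.Bool.Properties
  using (xor-comm; xor-assoc; ∨-zeroʳ; xor-identityˡ; xor-identityʳ; xor-same; not-involutive; not-distribˡ-xor;
         ∧-zeroˡ; ∧-zeroʳ; xor-∧-commutativeRing)
  renaming (_≟_ to _≟ᵇ_)
open import Data.Fin using (Fin; zero; suc)
open import Data.Fin.Properties using (_≟_)
open import Data.Vec using ([]; _∷_; zipWith; tabulate)
open import Data.Vec.Properties
  using (≡-dec; zipWith-assoc; zipWith-comm; zipWith-identityˡ; zipWith-identityʳ;
         zipWith-zeroˡ; zipWith-zeroʳ; zipWith-inverseʳ; map-id)
open import Data.List using (List; []; _∷_; _++_; map; [_]; filter)
open import Data.List.Relation.Unary.All using (All; []; _∷_)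
open import Data.List.Relation.Unary.Any using (here; there)
open import Data.List.Membership.Propositional using (_∈_)
open import Data.List.Membership.Propositional.Properties using (∈-map⁺; ∈-++⁺ˡ; ∈-++⁺ʳ; ∈-filter⁺)
open import Data.List.Relation.Unary.All.Properties using (all-filter)
open import Data.Maybe using (just; nothing)
open import Data.Empty using (⊥-elim)
open import Data.Sum using (_⊎_; inj₁; inj₂)
open import Data.Product using (_×_; _,_; Σ)
open import Relation.Binary.PropositionalEquality using (_≡_; _≢_; refl; sym; trans; cong; cong₂; subst; module ≡-Reasoning)
open import Relation.Nullary using (yes; no)
open import Relation.Nullary.Decidable using (does; dec-true)
open import Tactic.RingSolver using (solve-∀)
open import Tactic.RingSolver.Core.AlmostCommutativeRing
  using (AlmostCommutativeRing; fromCommutativeRing)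

open ≡-Reasoning

-- The solver computes coefficients in the ring itself, so it also knows x xor x ≡ false.
𝔽₂ : AlmostCommutativeRing _ _
𝔽₂ = fromCommutativeRing xor-∧-commutativeRing λ { false → just refl ; true → nothing }

true-or-false : ∀ b → b ≡ true ⊎ b ≡ false
true-or-false true  = inj₁ refl
true-or-false false = inj₂ refl

parity : ℕ → Bool
parity zero    = false
parity (suc m) = not (parity m)

parity-+ : ∀ m n → parity (m + n) ≡ parity m xor parity n
parity-+ zero    n = refl
parity-+ (suc m) n = trans (cong not (parity-+ m n)) (not-distribˡ-xor (parity m) (parity n))

parity-* : ∀ m n → parity (m * n) ≡ parity m ∧ parity n
parity-* zero    n = refl
parity-* (suc m) n = begin
  parity (n + m * n)                   ≡⟨ parity-+ n (m * n) ⟩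
  parity n xor parity (m * n)          ≡⟨ cong (parity n xor_) (parity-* m n) ⟩
  parity n xor (parity m ∧ parity n)   ≡⟨ identity (parity m) (parity n) ⟩
  not (parity m) ∧ parity n            ∎
  where
  identity : ∀ a b → b xor (a ∧ b) ≡ (true xor a) ∧ b
  identity = solve-∀ 𝔽₂

parity≡false⇒%2≡0 : ∀ m → parity m ≡ false → m % 2 ≡ 0
parity≡false⇒%2≡0 zero          _ = refl
parity≡false⇒%2≡0 (suc zero)    ()
parity≡false⇒%2≡0 (suc (suc m)) h = parity≡false⇒%2≡0 m (trans (sym (not-involutive (parity m))) h)

choose₂ : ℕ → ℕ
choose₂ zero    = 0
choose₂ (suc k) = k + choose₂ k

parity-choose₂-4+ : ∀ k → parity (choose₂ (4 + k)) ≡ parity (choose₂ k)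
parity-choose₂-4+ k = begin
  parity (choose₂ (4 + k))
    ≡⟨ step (3 + k) ⟩
  p₃ xor parity (choose₂ (3 + k))
    ≡⟨ cong (p₃ xor_) (step (2 + k)) ⟩
  p₃ xor (p₂ xor parity (choose₂ (2 + k)))
    ≡⟨ cong (λ z → p₃ xor (p₂ xor z)) (step (1 + k)) ⟩
  p₃ xor (p₂ xor (p₁ xor parity (choose₂ (1 + k))))
    ≡⟨ cong (λ z → p₃ xor (p₂ xor (p₁ xor z))) (step k) ⟩
  p₃ xor (p₂ xor (p₁ xor (parity k xor parity (choose₂ k))))
    ≡⟨ cancel (parity k) (parity (choose₂ k)) ⟩
  parity (choose₂ k) ∎
  where
  p₁ = parity (1 + k)
  p₂ = parity (2 + k)
  p₃ = parity (3 + k)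
  step : ∀ m → parity (choose₂ (suc m)) ≡ parity m xor parity (choose₂ m)
  step m = parity-+ m (choose₂ m)
  cancel : ∀ p c → (true xor (true xor (true xor p))) xor
                   ((true xor (true xor p)) xor ((true xor p) xor (p xor c))) ≡ c
  cancel = solve-∀ 𝔽₂

parity-choose₂≡false⇒%4 : ∀ k → parity (choose₂ k) ≡ false → k % 4 ≡ 0 ⊎ k % 4 ≡ 1
parity-choose₂≡false⇒%4 0 _ = inj₁ refl
parity-choose₂≡false⇒%4 1 _ = inj₂ refl
parity-choose₂≡false⇒%4 2 ()
parity-choose₂≡false⇒%4 3 ()
parity-choose₂≡false⇒%4 (suc (suc (suc (suc k)))) h =
  parity-choose₂≡false⇒%4 k (trans (sym (parity-choose₂-4+ k)) h)

%4⇒parity-choose₂≡false : ∀ k → k % 4 ≡ 0 ⊎ k % 4 ≡ 1 → parity (choose₂ k) ≡ false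
%4⇒parity-choose₂≡false 0 _ = refl
%4⇒parity-choose₂≡false 1 _ = refl
%4⇒parity-choose₂≡false 2 (inj₁ ())
%4⇒parity-choose₂≡false 2 (inj₂ ())
%4⇒parity-choose₂≡false 3 (inj₁ ())
%4⇒parity-choose₂≡false 3 (inj₂ ())
%4⇒parity-choose₂≡false (suc (suc (suc (suc k)))) h =
  trans (parity-choose₂-4+ k) (%4⇒parity-choose₂≡false k h)

module _ {n : ℕ} where

  ⊕-assoc : ∀ (x y z : Word n) → (x ⊕ y) ⊕ z ≡ x ⊕ (y ⊕ z)
  ⊕-assoc = zipWith-assoc xor-assoc

  ⊕-comm : ∀ (x y : Word n) → x ⊕ y ≡ y ⊕ x
  ⊕-comm = zipWith-comm xor-comm

  ⊕-identityˡ : ∀ (x : Word n) → 𝟎 n ⊕ x ≡ x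
  ⊕-identityˡ = zipWith-identityˡ xor-identityˡ

  ⊕-identityʳ : ∀ (x : Word n) → x ⊕ 𝟎 n ≡ x
  ⊕-identityʳ = zipWith-identityʳ xor-identityʳ

  ⊕-self : ∀ (x : Word n) → x ⊕ x ≡ 𝟎 n
  ⊕-self x = trans (cong (x ⊕_) (sym (map-id x))) (zipWith-inverseʳ xor-same x)

  ⊕-cancelʳ : ∀ (x y : Word n) → (x ⊕ y) ⊕ y ≡ x
  ⊕-cancelʳ x y = begin
    (x ⊕ y) ⊕ y  ≡⟨ ⊕-assoc x y y ⟩
    x ⊕ (y ⊕ y)  ≡⟨ cong (x ⊕_) (⊕-self y) ⟩
    x ⊕ 𝟎 n      ≡⟨ ⊕-identityʳ x ⟩
    x            ∎

  ⊕-cancelˡ : ∀ (x y : Word n) → x ⊕ (x ⊕ y) ≡ y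
  ⊕-cancelˡ x y = trans (⊕-comm x (x ⊕ y)) (trans (cong (_⊕ x) (⊕-comm x y)) (⊕-cancelʳ y x))

  ⊕-swapʳ : ∀ (x y z : Word n) → (x ⊕ y) ⊕ z ≡ (x ⊕ z) ⊕ y
  ⊕-swapʳ x y z = begin
    (x ⊕ y) ⊕ z  ≡⟨ ⊕-assoc x y z ⟩
    x ⊕ (y ⊕ z)  ≡⟨ cong (x ⊕_) (⊕-comm y z) ⟩
    x ⊕ (z ⊕ y)  ≡⟨ ⊕-assoc x z y ⟨
    (x ⊕ z) ⊕ y  ∎

  ⊕-interchange : ∀ (x y z : Word n) → (x ⊕ z) ⊕ (y ⊕ z) ≡ x ⊕ y
  ⊕-interchange x y z = begin
    (x ⊕ z) ⊕ (y ⊕ z)  ≡⟨ ⊕-swapʳ x z (y ⊕ z) ⟩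
    (x ⊕ (y ⊕ z)) ⊕ z  ≡⟨ cong (_⊕ z) (⊕-assoc x y z) ⟨
    ((x ⊕ y) ⊕ z) ⊕ z  ≡⟨ ⊕-cancelʳ (x ⊕ y) z ⟩
    x ⊕ y              ∎

e-zero : ∀ {n} → e {suc n} zero ≡ true ∷ 𝟎 n
e-zero {n} = cong (true ∷_) (tabulate-false n)
  where
  tabulate-false : ∀ n → tabulate {n = n} (λ _ → false) ≡ 𝟎 n
  tabulate-false zero    = refl
  tabulate-false (suc n) = cong (false ∷_) (tabulate-false n)

allWords : ∀ n → List (Word n)
allWords zero    = [ [] ]
allWords (suc n) = map (true ∷_) (allWords n) ++ map (false ∷_) (allWords n)

∈-allWords : ∀ {n} (x : Word n) → x ∈ allWords n
∈-allWords []                  = here refl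
∈-allWords         (true ∷ x)  = ∈-++⁺ˡ (∈-map⁺ (true ∷_) (∈-allWords x))
∈-allWords {suc n} (false ∷ x) = ∈-++⁺ʳ (map (true ∷_) (allWords n)) (∈-map⁺ (false ∷_) (∈-allWords x))

wt-𝟎 : ∀ n → wt (𝟎 n) ≡ 0
wt-𝟎 zero    = refl
wt-𝟎 (suc n) = wt-𝟎 n

wt-e : ∀ {n} (i : Fin n) → wt (e i) ≡ 1
wt-e {suc n} zero = trans (cong wt (e-zero {n})) (cong suc (wt-𝟎 n))
wt-e (suc i)      = wt-e i

parity-wt-∷ : ∀ {n} a (x : Word n) → parity (wt (a ∷ x)) ≡ a xor parity (wt x)
parity-wt-∷ true  x = refl
parity-wt-∷ false x = refl

parity-wt-⊕ : ∀ {n} (x y : Word n) → parity (wt (x ⊕ y)) ≡ parity (wt x) xor parity (wt y)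
parity-wt-⊕ []      []      = refl
parity-wt-⊕ (a ∷ x) (b ∷ y) = begin
  parity (wt ((a xor b) ∷ (x ⊕ y)))               ≡⟨ parity-wt-∷ (a xor b) (x ⊕ y) ⟩
  (a xor b) xor parity (wt (x ⊕ y))               ≡⟨ cong ((a xor b) xor_) (parity-wt-⊕ x y) ⟩
  (a xor b) xor (parity (wt x) xor parity (wt y)) ≡⟨ interchange a b (parity (wt x)) (parity (wt y)) ⟩
  (a xor parity (wt x)) xor (b xor parity (wt y)) ≡⟨ cong₂ _xor_ (parity-wt-∷ a x) (parity-wt-∷ b y) ⟨
  parity (wt (a ∷ x)) xor parity (wt (b ∷ y))     ∎
  where
  interchange : ∀ a b p q → (a xor b) xor (p xor q) ≡ (a xor p) xor (b xor q)
  interchange = solve-∀ 𝔽₂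

common-e : ∀ {n} (i j : Fin n) → i ≢ j → common (e i) (e j) ≡ 0
common-e zero zero i≢j = ⊥-elim (i≢j refl)
common-e {suc n} zero (suc j) _ = begin
  common (e zero) (e (suc j))            ≡⟨ cong (λ z → common z (e (suc j))) (e-zero {n}) ⟩
  wt (zipWith _∧_ (𝟎 n) (e j))           ≡⟨ cong wt (zipWith-zeroˡ ∧-zeroˡ (e j)) ⟩
  wt (𝟎 n)                               ≡⟨ wt-𝟎 n ⟩
  0                                      ∎
common-e {suc n} (suc i) zero _ = begin
  common (e (suc i)) (e zero)            ≡⟨ cong (common (e (suc i))) (e-zero {n}) ⟩
  wt (zipWith _∧_ (e i) (𝟎 n))           ≡⟨ cong wt (zipWith-zeroʳ ∧-zeroʳ (e i)) ⟩
  wt (𝟎 n)                               ≡⟨ wt-𝟎 n ⟩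
  0                                      ∎
common-e (suc i) (suc j) i≢j = common-e i j (λ i≡j → i≢j (cong suc i≡j))

module _ {n : ℕ} where

  _⊆_ : (S T : Word n → Bool) → Set
  S ⊆ T = ∀ x → S x ≡ true → T x ≡ true

  Closed : (Word n → Bool) → Set
  Closed S = ∀ x y → S x ≡ true → S y ≡ true → S (x ⊕ y) ≡ true

  closed-∉ : ∀ {S} → Closed S → ∀ x y → S x ≡ true → S y ≡ false → S (y ⊕ x) ≡ false
  closed-∉ {S} S-closed x y Sx Sy with S (y ⊕ x) in Syx
  ... | false = refl
  ... | true  = trans (sym (subst (λ z → S z ≡ true) (⊕-cancelʳ y x) (S-closed (y ⊕ x) x Syx Sx))) Sy

  zeroSet : Word n → Bool
  zeroSet y = does (≡-dec _≟ᵇ_ y (𝟎 n))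

  zeroSet-sound : ∀ y → zeroSet y ≡ true → y ≡ 𝟎 n
  zeroSet-sound y h with ≡-dec _≟ᵇ_ y (𝟎 n)
  zeroSet-sound y h  | yes y≡𝟎 = y≡𝟎
  zeroSet-sound y () | no _

  zeroSet-𝟎 : zeroSet (𝟎 n) ≡ true
  zeroSet-𝟎 = dec-true (≡-dec _≟ᵇ_ (𝟎 n) (𝟎 n)) refl

  zeroSet-⊆ : ∀ {P} → P (𝟎 n) ≡ true → zeroSet ⊆ P
  zeroSet-⊆ {P} P𝟎 y h = subst (λ z → P z ≡ true) (sym (zeroSet-sound y h)) P𝟎

  zeroSet-closed : Closed zeroSet
  zeroSet-closed x y hx hy = begin
    zeroSet (x ⊕ y)          ≡⟨ cong₂ (λ u v → zeroSet (u ⊕ v)) (zeroSet-sound x hx) (zeroSet-sound y hy) ⟩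
    zeroSet (𝟎 n ⊕ 𝟎 n)      ≡⟨ cong zeroSet (⊕-self (𝟎 n)) ⟩
    zeroSet (𝟎 n)            ≡⟨ zeroSet-𝟎 ⟩
    true                     ∎

  adjoin : (Word n → Bool) → Word n → Word n → Bool
  adjoin S w y = S y ∨ S (y ⊕ w)

  module _ (S : Word n → Bool) (w : Word n) where

    adjoin-⊇ : S ⊆ adjoin S w
    adjoin-⊇ y Sy = cong (_∨ S (y ⊕ w)) Sy

    adjoin-coset : ∀ y → S (y ⊕ w) ≡ true → adjoin S w y ≡ true
    adjoin-coset y h = trans (cong (S y ∨_) h) (∨-zeroʳ (S y))

    adjoin-∋ : S (𝟎 n) ≡ true → adjoin S w w ≡ true
    adjoin-∋ S𝟎 = adjoin-coset w (subst (λ z → S z ≡ true) (sym (⊕-self w)) S𝟎)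

    adjoin-∉ : ∀ y → adjoin S w y ≡ true → S y ≡ false → S (y ⊕ w) ≡ true
    adjoin-∉ y h Sy = trans (cong (_∨ S (y ⊕ w)) (sym Sy)) h

    adjoin-closed : Closed S → Closed (adjoin S w)
    adjoin-closed S-closed x y hx hy with S x in Sx | S y in Sy
    ... | true  | true  = adjoin-⊇ (x ⊕ y) (S-closed x y Sx Sy)
    ... | true  | false = adjoin-coset (x ⊕ y)
      (subst (λ z → S z ≡ true) (sym (⊕-assoc x y w)) (S-closed x (y ⊕ w) Sx hy))
    ... | false | true  = adjoin-coset (x ⊕ y)
      (subst (λ z → S z ≡ true) (⊕-swapʳ x w y) (S-closed (x ⊕ w) y hx Sy))
    ... | false | false = adjoin-⊇ (x ⊕ y)
      (subst (λ z → S z ≡ true) (⊕-interchange x y w) (S-closed (x ⊕ w) (y ⊕ w) hx hy))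

  spanFrom : (Word n → Bool) → List (Word n) → Word n → Bool
  spanFrom S []       = S
  spanFrom S (w ∷ ws) = adjoin (spanFrom S ws) w

  module _ (S : Word n → Bool) where

    spanFrom-⊇ : ∀ ws → S ⊆ spanFrom S ws
    spanFrom-⊇ []       y Sy = Sy
    spanFrom-⊇ (w ∷ ws) y Sy = adjoin-⊇ (spanFrom S ws) w y (spanFrom-⊇ ws y Sy)

    spanFrom-closed : Closed S → ∀ ws → Closed (spanFrom S ws)
    spanFrom-closed S-closed []       = S-closed
    spanFrom-closed S-closed (w ∷ ws) = adjoin-closed (spanFrom S ws) w (spanFrom-closed S-closed ws)

    spanFrom-∋ : S (𝟎 n) ≡ true → ∀ {w ws} → w ∈ ws → spanFrom S ws w ≡ true
    spanFrom-∋ S𝟎 {ws = w ∷ ws} (here refl) = adjoin-∋ (spanFrom S ws) w (spanFrom-⊇ ws (𝟎 n) S𝟎)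
    spanFrom-∋ S𝟎 {w} {v ∷ ws} (there w∈ws) = adjoin-⊇ (spanFrom S ws) v w (spanFrom-∋ S𝟎 w∈ws)

    spanFrom-⊆ : ∀ {P} → Closed P → S ⊆ P → ∀ {ws} → All (λ w → P w ≡ true) ws → spanFrom S ws ⊆ P
    spanFrom-⊆ P-closed S⊆P []                 = S⊆P
    spanFrom-⊆ {P} P-closed S⊆P {w ∷ ws} (Pw ∷ Pws) y hy with spanFrom S ws y in Sy
    ... | true  = spanFrom-⊆ P-closed S⊆P Pws y Sy
    ... | false = subst (λ z → P z ≡ true) (⊕-cancelʳ y w)
                    (P-closed (y ⊕ w) w (spanFrom-⊆ P-closed S⊆P Pws (y ⊕ w) hy) Pw)

-- Quadratic refinements

module BilinearForm {n : ℕ} (B : Word n → Word n → Bool)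
  (B-⊕ˡ : ∀ x y z → B (x ⊕ y) z ≡ B x z xor B y z)
  (B-⊕ʳ : ∀ x y z → B x (y ⊕ z) ≡ B x y xor B x z) where

  B-𝟎ˡ : ∀ y → B (𝟎 n) y ≡ false
  B-𝟎ˡ y = begin
    B (𝟎 n) y                ≡⟨ cong (λ z → B z y) (⊕-self (𝟎 n)) ⟨
    B (𝟎 n ⊕ 𝟎 n) y          ≡⟨ B-⊕ˡ (𝟎 n) (𝟎 n) y ⟩
    B (𝟎 n) y xor B (𝟎 n) y  ≡⟨ xor-same (B (𝟎 n) y) ⟩
    false                    ∎

  B-𝟎ʳ : ∀ x → B x (𝟎 n) ≡ false
  B-𝟎ʳ x = begin
    B x (𝟎 n)                ≡⟨ cong (B x) (⊕-self (𝟎 n)) ⟨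
    B x (𝟎 n ⊕ 𝟎 n)          ≡⟨ B-⊕ʳ x (𝟎 n) (𝟎 n) ⟩
    B x (𝟎 n) xor B x (𝟎 n)  ≡⟨ xor-same (B x (𝟎 n)) ⟩
    false                    ∎

  B-⊕-⊕ : ∀ x y z w → B (x ⊕ y) (z ⊕ w) ≡ (B x z xor B x w) xor (B y z xor B y w)
  B-⊕-⊕ x y z w = trans (B-⊕ˡ x y (z ⊕ w)) (cong₂ _xor_ (B-⊕ʳ x z w) (B-⊕ʳ y z w))

  ω : Word n → Word n → Bool
  ω x y = B x y xor B y x

  ω-⊕ʳ : ∀ x y z → ω x (y ⊕ z) ≡ ω x y xor ω x z
  ω-⊕ʳ x y z = begin
    B x (y ⊕ z) xor B (y ⊕ z) x             ≡⟨ cong₂ _xor_ (B-⊕ʳ x y z) (B-⊕ˡ y z x) ⟩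
    (B x y xor B x z) xor (B y x xor B z x) ≡⟨ interchange (B x y) (B x z) (B y x) (B z x) ⟩
    ω x y xor ω x z                         ∎
    where
    interchange : ∀ a b c d → (a xor b) xor (c xor d) ≡ (a xor c) xor (b xor d)
    interchange = solve-∀ 𝔽₂

  ω-𝟎ʳ : ∀ x → ω x (𝟎 n) ≡ false
  ω-𝟎ʳ x = cong₂ _xor_ (B-𝟎ʳ x) (B-𝟎ˡ x)

  polarization : ∀ x y → B (x ⊕ y) (x ⊕ y) ≡ B x x xor (B y y xor ω x y)
  polarization x y = trans (B-⊕-⊕ x y x y) (regroup (B x x) (B x y) (B y x) (B y y))
    where
    regroup : ∀ a b c d → (a xor b) xor (c xor d) ≡ a xor (d xor (b xor c))
    regroup = solve-∀ 𝔽₂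

  Alternating : (Word n → Bool) → Set
  Alternating S = ∀ x → S x ≡ true → B x x ≡ false

  alternating⇒ω≡false : ∀ {S} → Closed S → Alternating S →
                        ∀ x y → S x ≡ true → S y ≡ true → ω x y ≡ false
  alternating⇒ω≡false S-closed alt x y Sx Sy = begin
    ω x y                              ≡⟨⟩
    false xor (false xor ω x y)        ≡⟨ cong₂ (λ u v → u xor (v xor ω x y)) (alt x Sx) (alt y Sy) ⟨
    B x x xor (B y y xor ω x y)        ≡⟨ polarization x y ⟨
    B (x ⊕ y) (x ⊕ y)                  ≡⟨ alt (x ⊕ y) (S-closed x y Sx Sy) ⟩
    false                              ∎

  alternating⇒symmetric : ∀ {S} → Closed S → Alternating S →
                          ∀ x y → S x ≡ true → S y ≡ true → B x y ≡ B y x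
  alternating⇒symmetric S-closed alt x y Sx Sy =
    xor≡false⇒≡ (B x y) (B y x) (alternating⇒ω≡false S-closed alt x y Sx Sy)
    where
    xor≡false⇒≡ : ∀ a b → a xor b ≡ false → a ≡ b
    xor≡false⇒≡ false false _  = refl
    xor≡false⇒≡ true  true  _  = refl
    xor≡false⇒≡ false true  ()
    xor≡false⇒≡ true  false ()

  Refines : (S T K : Word n → Bool) → Set
  Refines S T K = ∀ y x → S y ≡ true → T x ≡ true → K (y ⊕ x) ≡ K y xor (K x xor B y x)

  extend : (S K : Word n → Bool) → Word n → Word n → Bool
  extend S K w y = if S y then K y else K (y ⊕ w) xor B w (y ⊕ w)

  module _ (S K : Word n → Bool) (w : Word n) where

    extend-in : ∀ y → S y ≡ true → extend S K w y ≡ K y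
    extend-in y Sy = cong (λ b → if b then K y else K (y ⊕ w) xor B w (y ⊕ w)) Sy

    extend-out : ∀ {y} s → y ⊕ w ≡ s → S y ≡ false → extend S K w y ≡ K s xor B w s
    extend-out s refl Sy = cong (λ b → if b then K _ else K s xor B w s) Sy

    private
      ext = extend S K w

    extend-refines : ∀ {T} → Closed S → T ⊆ S → Refines S T K →
                     Refines (adjoin S w) T (extend S K w)
    extend-refines S-closed T⊆S K-refines y x hy Tx with true-or-false (S y)
    ... | inj₁ Sy = begin
      ext (y ⊕ x)                  ≡⟨ extend-in (y ⊕ x) (S-closed y x Sy Sx) ⟩
      K (y ⊕ x)                    ≡⟨ K-refines y x Sy Tx ⟩
      K y xor (K x xor B y x)      ≡⟨ cong₂ (λ u v → u xor (v xor B y x)) (extend-in y Sy) (extend-in x Sx) ⟨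
      ext y xor (ext x xor B y x)  ∎
      where
      Sx = T⊆S x Tx
    ... | inj₂ Sy = begin
      ext (y ⊕ x)
        ≡⟨ extend-out (s ⊕ x) (⊕-swapʳ y x w) (closed-∉ S-closed x y Sx Sy) ⟩
      K (s ⊕ x) xor B w (s ⊕ x)
        ≡⟨ cong₂ _xor_ (K-refines s x Ss Tx) (B-⊕ʳ w s x) ⟩
      (K s xor (K x xor B s x)) xor (B w s xor B w x)
        ≡⟨ regroup (K s) (K x) (B s x) (B w s) (B w x) ⟩
      (K s xor B w s) xor (K x xor (B s x xor B w x))
        ≡⟨ cong₂ (λ u v → u xor (v xor (B s x xor B w x))) (extend-out s refl Sy) (extend-in x Sx) ⟨
      ext y xor (ext x xor (B s x xor B w x))
        ≡⟨ cong (λ z → ext y xor (ext x xor z)) (B-⊕ˡ s w x) ⟨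
      ext y xor (ext x xor B (s ⊕ w) x)
        ≡⟨ cong (λ z → ext y xor (ext x xor B z x)) (⊕-cancelʳ y w) ⟩
      ext y xor (ext x xor B y x)  ∎
      where
      Sx = T⊆S x Tx
      s  = y ⊕ w
      Ss = adjoin-∉ S w y hy Sy
      regroup : ∀ a b c d f → (a xor (b xor c)) xor (d xor f) ≡ (a xor d) xor (b xor (c xor f))
      regroup = solve-∀ 𝔽₂

    module _ (S𝟎 : S (𝟎 n) ≡ true) (S-closed : Closed S) (alt : Alternating (adjoin S w))
             (K-refines : Refines S S K) where

      private
        symmetric : ∀ x y → adjoin S w x ≡ true → adjoin S w y ≡ true → B x y ≡ B y x
        symmetric = alternating⇒symmetric (adjoin-closed S w S-closed) alt

      extend-refines-outside : ∀ y x → adjoin S w y ≡ true → adjoin S w x ≡ true →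
                               S y ≡ false → S x ≡ false → ext (y ⊕ x) ≡ ext y xor (ext x xor B y x)
      extend-refines-outside y x hy hx Sy Sx = begin
        ext (y ⊕ x)                  ≡⟨ cong ext (⊕-interchange y x w) ⟨
        ext (s ⊕ t)                  ≡⟨ extend-in (s ⊕ t) (S-closed s t Ss St) ⟩
        K (s ⊕ t)                    ≡⟨ K-refines s t Ss St ⟩
        K s xor (K t xor B s t)      ≡⟨ expand (K s) (K t) (B s t) (B w s) (B w t) ⟩
        (K s xor B w s) xor ((K t xor B w t) xor ((B s t xor B w s) xor (B w t xor false)))
          ≡⟨ cong₂ (λ u v → (K s xor B w s) xor ((K t xor B w t) xor ((B s t xor u) xor (B w t xor v))))
                   (symmetric w s w∈ s∈) (sym (alt w w∈)) ⟩
        (K s xor B w s) xor ((K t xor B w t) xor ((B s t xor B s w) xor (B w t xor B w w)))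
          ≡⟨ cong₂ (λ u v → u xor (v xor ((B s t xor B s w) xor (B w t xor B w w))))
                   (extend-out s refl Sy) (extend-out t refl Sx) ⟨
        ext y xor (ext x xor ((B s t xor B s w) xor (B w t xor B w w)))
          ≡⟨ cong (λ z → ext y xor (ext x xor z)) (B-⊕-⊕ s w t w) ⟨
        ext y xor (ext x xor B (s ⊕ w) (t ⊕ w))
          ≡⟨ cong₂ (λ u v → ext y xor (ext x xor B u v)) (⊕-cancelʳ y w) (⊕-cancelʳ x w) ⟩
        ext y xor (ext x xor B y x)  ∎
        where
        s  = y ⊕ w
        t  = x ⊕ w
        Ss = adjoin-∉ S w y hy Sy
        St = adjoin-∉ S w x hx Sx
        w∈ = adjoin-∋ S w S𝟎
        s∈ = adjoin-⊇ S w s Ss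
        expand : ∀ a b c d f → a xor (b xor c) ≡ (a xor d) xor ((b xor f) xor ((c xor d) xor (f xor false)))
        expand = solve-∀ 𝔽₂

      extend-refines-self : Refines (adjoin S w) (adjoin S w) (extend S K w)
      extend-refines-self y x hy hx with true-or-false (S x) | true-or-false (S y)
      ... | inj₁ Sx | _       = extend-refines S-closed (λ _ h → h) K-refines y x hy Sx
      ... | inj₂ Sx | inj₂ Sy = extend-refines-outside y x hy hx Sy Sx
      ... | inj₂ Sx | inj₁ Sy = begin
        ext (y ⊕ x)                  ≡⟨ cong ext (⊕-comm y x) ⟩
        ext (x ⊕ y)                  ≡⟨ extend-refines S-closed (λ _ h → h) K-refines x y hx Sy ⟩
        ext x xor (ext y xor B x y)  ≡⟨ cong (λ z → ext x xor (ext y xor z)) (symmetric x y hx hy) ⟩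
        ext x xor (ext y xor B y x)  ≡⟨ swap (ext x) (ext y) (B y x) ⟩
        ext y xor (ext x xor B y x)  ∎
        where
        swap : ∀ a b c → a xor (b xor c) ≡ b xor (a xor c)
        swap = solve-∀ 𝔽₂

  refineFrom : (S K : Word n → Bool) → List (Word n) → Word n → Bool
  refineFrom S K []       = K
  refineFrom S K (w ∷ ws) = extend (spanFrom S ws) (refineFrom S K ws) w

  module _ {S K : Word n → Bool} (S-closed : Closed S) where

    refineFrom-refines : ∀ {T} → T ⊆ S → Refines S T K →
                         ∀ ws → Refines (spanFrom S ws) T (refineFrom S K ws)
    refineFrom-refines T⊆S K-refines []       = K-refines
    refineFrom-refines T⊆S K-refines (w ∷ ws) =
      extend-refines (spanFrom S ws) (refineFrom S K ws) w (spanFrom-closed S S-closed ws)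
        (λ x Tx → spanFrom-⊇ S ws x (T⊆S x Tx)) (refineFrom-refines T⊆S K-refines ws)

    refineFrom-refines-self : S (𝟎 n) ≡ true → Refines S S K →
                              ∀ ws → Alternating (spanFrom S ws) →
                              Refines (spanFrom S ws) (spanFrom S ws) (refineFrom S K ws)
    refineFrom-refines-self S𝟎 K-refines []       _   = K-refines
    refineFrom-refines-self S𝟎 K-refines (w ∷ ws) alt =
      extend-refines-self (spanFrom S ws) (refineFrom S K ws) w (spanFrom-⊇ S ws (𝟎 n) S𝟎)
        (spanFrom-closed S S-closed ws) alt
        (refineFrom-refines-self S𝟎 K-refines ws (λ x h → alt x (adjoin-⊇ (spanFrom S ws) w x h)))

  -- First refine B on P itself, adjoining the elements of P one at a time to {𝟎};
  -- then extend from P to all words keeping only the second argument in P,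
  -- which needs no alternation.
  alternating⇒refinable : ∀ {P} → Closed P → P (𝟎 n) ≡ true → Alternating P →
                          Σ (Word n → Bool) (Refines (λ _ → true) P)
  alternating⇒refinable {P} P-closed P𝟎 alt =
    refineFrom P K (allWords n) ,
    λ v x _ Px → refineFrom-refines P-closed (λ _ h → h) K-refines (allWords n) v x
                   (spanFrom-∋ P P𝟎 (∈-allWords v)) Px
    where
    P? = λ w → P w ≟ᵇ true
    gens = filter P? (allWords n)
    S = spanFrom zeroSet gens
    K = refineFrom zeroSet (λ _ → false) gens

    S⊆P : S ⊆ P
    S⊆P = spanFrom-⊆ zeroSet P-closed (zeroSet-⊆ P𝟎) (all-filter P? (allWords n))

    P⊆S : P ⊆ S
    P⊆S x Px = spanFrom-∋ zeroSet (zeroSet-𝟎 {n}) (∈-filter⁺ P? (∈-allWords x) Px)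

    refines-zeroSet : Refines zeroSet zeroSet (λ _ → false)
    refines-zeroSet y x y∈ _ = sym (trans (cong (λ z → B z x) (zeroSet-sound y y∈)) (B-𝟎ˡ x))

    K-refines : Refines P P K
    K-refines y x Py Px =
      refineFrom-refines-self zeroSet-closed (zeroSet-𝟎 {n}) refines-zeroSet gens (λ z h → alt z (S⊆P z h))
        y x (P⊆S y Py) (P⊆S x Px)

-- The sign cocycle

-- β (e i) v is the parity of the part of v below i: the usual sign rule making
-- the reflections of the cube pairwise anticommute.
β : ∀ {n} → Word n → Word n → Bool
β []      []      = false
β (a ∷ x) (b ∷ y) = (b ∧ parity (wt x)) xor β x y

β-⊕ˡ : ∀ {n} (x x′ y : Word n) → β (x ⊕ x′) y ≡ β x y xor β x′ y
β-⊕ˡ []      []        []      = refl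
β-⊕ˡ (a ∷ x) (a′ ∷ x′) (b ∷ y) = begin
  (b ∧ parity (wt (x ⊕ x′))) xor β (x ⊕ x′) y
    ≡⟨ cong₂ (λ p q → (b ∧ p) xor q) (parity-wt-⊕ x x′) (β-⊕ˡ x x′ y) ⟩
  (b ∧ (parity (wt x) xor parity (wt x′))) xor (β x y xor β x′ y)
    ≡⟨ distrib b (parity (wt x)) (parity (wt x′)) (β x y) (β x′ y) ⟩
  ((b ∧ parity (wt x)) xor β x y) xor ((b ∧ parity (wt x′)) xor β x′ y) ∎
  where
  distrib : ∀ b p p′ q q′ → (b ∧ (p xor p′)) xor (q xor q′) ≡ ((b ∧ p) xor q) xor ((b ∧ p′) xor q′)
  distrib = solve-∀ 𝔽₂

β-⊕ʳ : ∀ {n} (x y y′ : Word n) → β x (y ⊕ y′) ≡ β x y xor β x y′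
β-⊕ʳ []      []      []        = refl
β-⊕ʳ (a ∷ x) (b ∷ y) (b′ ∷ y′) = begin
  ((b xor b′) ∧ parity (wt x)) xor β x (y ⊕ y′)
    ≡⟨ cong (((b xor b′) ∧ parity (wt x)) xor_) (β-⊕ʳ x y y′) ⟩
  ((b xor b′) ∧ parity (wt x)) xor (β x y xor β x y′)
    ≡⟨ distrib b b′ (parity (wt x)) (β x y) (β x y′) ⟩
  ((b ∧ parity (wt x)) xor β x y) xor ((b′ ∧ parity (wt x)) xor β x y′) ∎
  where
  distrib : ∀ b b′ p q q′ → ((b xor b′) ∧ p) xor (q xor q′) ≡ ((b ∧ p) xor q) xor ((b′ ∧ p) xor q′)
  distrib = solve-∀ 𝔽₂

β-diag : ∀ {n} (x : Word n) → β x x ≡ parity (choose₂ (wt x))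
β-diag []          = refl
β-diag (false ∷ x) = β-diag x
β-diag (true ∷ x)  = trans (cong (parity (wt x) xor_) (β-diag x)) (sym (parity-+ (wt x) (choose₂ (wt x))))

β-symmetrization : ∀ {n} (x y : Word n) → β x y xor β y x ≡ parity (common x y + wt x * wt y)
β-symmetrization []      []      = refl
β-symmetrization (a ∷ x) (b ∷ y) = begin
  ((b ∧ p x) xor β x y) xor ((a ∧ p y) xor β y x)
    ≡⟨ interchange (b ∧ p x) (β x y) (a ∧ p y) (β y x) ⟩
  ((b ∧ p x) xor (a ∧ p y)) xor (β x y xor β y x)
    ≡⟨ cong (((b ∧ p x) xor (a ∧ p y)) xor_) (trans (β-symmetrization x y) (parity-common-wt x y)) ⟩
  ((b ∧ p x) xor (a ∧ p y)) xor (parity (common x y) xor (p x ∧ p y))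
    ≡⟨ expand a b (p x) (p y) (parity (common x y)) ⟩
  ((a ∧ b) xor parity (common x y)) xor ((a xor p x) ∧ (b xor p y))
    ≡⟨ cong₂ _xor_ (parity-wt-∷ (a ∧ b) (zipWith _∧_ x y)) (cong₂ _∧_ (parity-wt-∷ a x) (parity-wt-∷ b y)) ⟨
  parity (common (a ∷ x) (b ∷ y)) xor (p (a ∷ x) ∧ p (b ∷ y))
    ≡⟨ parity-common-wt (a ∷ x) (b ∷ y) ⟨
  parity (common (a ∷ x) (b ∷ y) + wt (a ∷ x) * wt (b ∷ y)) ∎
  where
  p : ∀ {m} → Word m → Bool
  p z = parity (wt z)
  parity-common-wt : ∀ {m} (x y : Word m) →
                     parity (common x y + wt x * wt y) ≡ parity (common x y) xor (p x ∧ p y)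
  parity-common-wt x y = trans (parity-+ (common x y) _) (cong (parity (common x y) xor_) (parity-* (wt x) (wt y)))
  interchange : ∀ a b c d → (a xor b) xor (c xor d) ≡ (a xor c) xor (b xor d)
  interchange = solve-∀ 𝔽₂
  expand : ∀ a b p q c → ((b ∧ p) xor (a ∧ q)) xor (c xor (p ∧ q)) ≡ ((a ∧ b) xor c) xor ((a xor p) ∧ (b xor q))
  expand = solve-∀ 𝔽₂

β-e-diag : ∀ {n} (i : Fin n) → β (e i) (e i) ≡ false
β-e-diag i = trans (β-diag (e i)) (cong (λ k → parity (choose₂ k)) (wt-e i))

β-e-symmetrization : ∀ {n} (i j : Fin n) → i ≢ j → β (e i) (e j) xor β (e j) (e i) ≡ true
β-e-symmetrization i j i≢j = trans (β-symmetrization (e i) (e j))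
  (cong₂ (λ c k → parity (c + k)) (common-e i j i≢j) (cong₂ _*_ (wt-e i) (wt-e j)))

open module βForm {n} = BilinearForm {n} β β-⊕ˡ β-⊕ʳ

-- Signs of walks

displacement : ∀ {n} → List (Fin n) → Word n
displacement {n} []      = 𝟎 n
displacement     (i ∷ s) = e i ⊕ displacement s

support : ∀ {n} → Word n → List (Fin n)
support []          = []
support (true ∷ x)  = zero ∷ map suc (support x)
support (false ∷ x) = map suc (support x)

displacement-map-suc : ∀ {n} (s : List (Fin n)) → displacement (map suc s) ≡ false ∷ displacement s
displacement-map-suc []      = refl
displacement-map-suc (i ∷ s) = cong (e (suc i) ⊕_) (displacement-map-suc s)

displacement-support : ∀ {n} (x : Word n) → displacement (support x) ≡ x
displacement-support []          = refl
displacement-support (true ∷ x)  = begin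
  e zero ⊕ displacement (map suc (support x))  ≡⟨ cong₂ _⊕_ e-zero (displacement-map-suc (support x)) ⟩
  true ∷ (𝟎 _ ⊕ displacement (support x))      ≡⟨ cong (true ∷_) (⊕-identityˡ _) ⟩
  true ∷ displacement (support x)              ≡⟨ cong (true ∷_) (displacement-support x) ⟩
  true ∷ x                                     ∎
displacement-support (false ∷ x) =
  trans (displacement-map-suc (support x)) (cong (false ∷_) (displacement-support x))

module WalkSign {n} {L : Code n} (d : EdgeFunction L) where

  sign : Word n → List (Fin n) → Bool
  sign v []      = false
  sign v (i ∷ s) = val d v i xor sign (v ⊕ e i) s

  sign-++ : ∀ v s t → sign v (s ++ t) ≡ sign v s xor sign (v ⊕ displacement s) t
  sign-++ v []      t = cong (λ z → sign z t) (sym (⊕-identityʳ v))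
  sign-++ v (i ∷ s) t = begin
    val d v i xor sign (v ⊕ e i) (s ++ t)
      ≡⟨ cong (val d v i xor_) (sign-++ (v ⊕ e i) s t) ⟩
    val d v i xor (sign (v ⊕ e i) s xor sign ((v ⊕ e i) ⊕ displacement s) t)
      ≡⟨ xor-assoc (val d v i) _ _ ⟨
    sign v (i ∷ s) xor sign ((v ⊕ e i) ⊕ displacement s) t
      ≡⟨ cong (λ z → sign v (i ∷ s) xor sign z t) (⊕-assoc v (e i) (displacement s)) ⟩
    sign v (i ∷ s) xor sign (v ⊕ displacement (i ∷ s)) t ∎

  sign-shift : ∀ v x s → x ∈C L → sign (v ⊕ x) s ≡ sign v s
  sign-shift v x []      x∈L = refl
  sign-shift v x (i ∷ s) x∈L = cong₂ _xor_
    (coset-inv d (v ⊕ x) v i (subst (_∈C L) (sym (trans (⊕-comm (v ⊕ x) v) (⊕-cancelˡ v x))) x∈L))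
    (trans (cong (λ z → sign z s) (⊕-swapʳ v x (e i))) (sign-shift (v ⊕ e i) x s x∈L))

  sign-cancel : ∀ v p i t → sign v (p ++ i ∷ i ∷ t) ≡ sign v (p ++ t)
  sign-cancel v p i t = begin
    sign v (p ++ i ∷ i ∷ t)                ≡⟨ sign-++ v p (i ∷ i ∷ t) ⟩
    sign v p xor sign u (i ∷ i ∷ t)        ≡⟨ cong (sign v p xor_) back-and-forth ⟩
    sign v p xor sign u t                  ≡⟨ sign-++ v p t ⟨
    sign v (p ++ t)                        ∎
    where
    u = v ⊕ displacement p
    back-and-forth : sign u (i ∷ i ∷ t) ≡ sign u t
    back-and-forth = begin
      val d u i xor (val d (u ⊕ e i) i xor sign ((u ⊕ e i) ⊕ e i) t)
        ≡⟨ cong₂ (λ a z → val d u i xor (a xor sign z t)) (edge-inv d u i) (⊕-cancelʳ u (e i)) ⟩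
      val d u i xor (val d u i xor sign u t)
        ≡⟨ xor-assoc (val d u i) _ _ ⟨
      (val d u i xor val d u i) xor sign u t
        ≡⟨ cong (_xor sign u t) (xor-same (val d u i)) ⟩
      sign u t ∎

  module _ (odd : IsOddDashing d) where

    sign-swap : ∀ v i j t → sign v (i ∷ j ∷ t) ≡ ω (e i) (e j) xor sign v (j ∷ i ∷ t)
    sign-swap v i j t with i ≟ j
    ... | yes refl = sym (cong (_xor sign v (i ∷ i ∷ t)) (xor-same (β (e i) (e i))))
    ... | no i≢j = begin
      a xor (b xor sign ((v ⊕ e i) ⊕ e j) t)
        ≡⟨ split a b c f _ ⟩
      (a xor (b xor (c xor f))) xor (f xor (c xor sign ((v ⊕ e i) ⊕ e j) t))
        ≡⟨ cong₂ (λ u z → u xor (f xor (c xor sign z t))) square (⊕-swapʳ v (e i) (e j)) ⟩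
      true xor sign v (j ∷ i ∷ t)
        ≡⟨ cong (_xor sign v (j ∷ i ∷ t)) (β-e-symmetrization i j i≢j) ⟨
      ω (e i) (e j) xor sign v (j ∷ i ∷ t) ∎
      where
      a = val d v i
      b = val d (v ⊕ e i) j
      c = val d (v ⊕ e j) i
      f = val d v j
      square : a xor (b xor (c xor f)) ≡ true
      square = begin
        a xor (b xor (c xor f))
          ≡⟨ cong₂ (λ u z → a xor (b xor (u xor z)))
                   (trans (cong (λ z → val d z i) (⊕-swapʳ v (e i) (e j))) (edge-inv d (v ⊕ e j) i))
                   (edge-inv d v j) ⟨
        a xor (b xor (val d ((v ⊕ e i) ⊕ e j) i xor val d (v ⊕ e j) j))
          ≡⟨ odd v i j i≢j ⟩
        true ∎
      split : ∀ a b c f s → a xor (b xor s) ≡ (a xor (b xor (c xor f))) xor (f xor (c xor s))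
      split = solve-∀ 𝔽₂

    sign-move : ∀ v i bs t → sign v (i ∷ bs ++ t) ≡ ω (e i) (displacement bs) xor sign v (bs ++ i ∷ t)
    sign-move v i []       t = sym (cong (_xor sign v (i ∷ t)) (ω-𝟎ʳ (e i)))
    sign-move v i (b ∷ bs) t = begin
      sign v (i ∷ b ∷ bs ++ t)
        ≡⟨ sign-swap v i b (bs ++ t) ⟩
      ω (e i) (e b) xor (val d v b xor sign (v ⊕ e b) (i ∷ bs ++ t))
        ≡⟨ cong (λ z → ω (e i) (e b) xor (val d v b xor z)) (sign-move (v ⊕ e b) i bs t) ⟩
      ω (e i) (e b) xor (val d v b xor (ω (e i) (displacement bs) xor sign (v ⊕ e b) (bs ++ i ∷ t)))
        ≡⟨ regroup (ω (e i) (e b)) (val d v b) (ω (e i) (displacement bs)) _ ⟩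
      (ω (e i) (e b) xor ω (e i) (displacement bs)) xor sign v (b ∷ bs ++ i ∷ t)
        ≡⟨ cong (_xor sign v (b ∷ bs ++ i ∷ t)) (ω-⊕ʳ (e i) (e b) (displacement bs)) ⟨
      ω (e i) (displacement (b ∷ bs)) xor sign v (b ∷ bs ++ i ∷ t) ∎
      where
      regroup : ∀ a b c s → a xor (b xor (c xor s)) ≡ (a xor c) xor (b xor s)
      regroup = solve-∀ 𝔽₂

    sign-square : ∀ v s → sign v (s ++ s) ≡ β (displacement s) (displacement s)
    sign-square v []      = sym (B-𝟎ˡ (𝟎 n))
    sign-square v (i ∷ s) = begin
      sign v (i ∷ s ++ i ∷ s)          ≡⟨ sign-move v i s (i ∷ s) ⟩
      ω (e i) D xor sign v (s ++ i ∷ i ∷ s) ≡⟨ cong (ω (e i) D xor_) (trans (sign-cancel v s i s) (sign-square v s)) ⟩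
      ω (e i) D xor β D D               ≡⟨ xor-comm (ω (e i) D) (β D D) ⟩
      β D D xor ω (e i) D               ≡⟨ cong (λ z → z xor (β D D xor ω (e i) D)) (β-e-diag i) ⟨
      β (e i) (e i) xor (β D D xor ω (e i) D) ≡⟨ polarization (e i) D ⟨
      β (e i ⊕ D) (e i ⊕ D)             ∎
      where
      D = displacement s

oddDashing⇒alternating : ∀ {n} {L : Code n} → HasOddDashing L → Alternating (mem L)
oddDashing⇒alternating {n} {L} (d , odd) x x∈L = begin
  β x x                                  ≡⟨ cong (λ z → β z z) (displacement-support x) ⟨
  β (displacement s) (displacement s)    ≡⟨ sign-square odd (𝟎 n) s ⟨
  sign (𝟎 n) (s ++ s)                    ≡⟨ sign-++ (𝟎 n) s s ⟩
  sign (𝟎 n) s xor sign (𝟎 n ⊕ displacement s) s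
    ≡⟨ cong (λ z → sign (𝟎 n) s xor sign (𝟎 n ⊕ z) s) (displacement-support x) ⟩
  sign (𝟎 n) s xor sign (𝟎 n ⊕ x) s      ≡⟨ cong (sign (𝟎 n) s xor_) (sign-shift (𝟎 n) x s x∈L) ⟩
  sign (𝟎 n) s xor sign (𝟎 n) s          ≡⟨ xor-same (sign (𝟎 n) s) ⟩
  false                                  ∎
  where
  open WalkSign d
  s = support x

alternating⇒dashing : ∀ {n} (L : Code n) → Alternating (mem L) → IsDashingCode L
alternating⇒dashing L alt =
  (λ w w∈L → parity-choose₂≡false⇒%4 (wt w) (trans (sym (β-diag w)) (alt w w∈L))) ,
  (λ w₁ w₂ w₁∈L w₂∈L → parity≡false⇒%2≡0 (common w₁ w₂ + wt w₁ * wt w₂)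
     (trans (sym (β-symmetrization w₁ w₂)) (alternating⇒ω≡false (mem-⊕ L) alt w₁ w₂ w₁∈L w₂∈L)))

dashing⇒alternating : ∀ {n} (L : Code n) → IsDashingCode L → Alternating (mem L)
dashing⇒alternating L (weights , _) x x∈L =
  trans (β-diag x) (%4⇒parity-choose₂≡false (wt x) (weights x x∈L))

-- Odd dashings from refinements

module TwistedDashing {n} (L : Code n) (g : Word n → Bool)
                      (g-refines : Refines (λ _ → true) (mem L) g) where

  dash : Word n → Fin n → Bool
  dash v i = β (e i) v xor (g v xor g (v ⊕ e i))

  dash-shift : ∀ v x i → x ∈C L → dash (v ⊕ x) i ≡ dash v i
  dash-shift v x i x∈L = begin
    β (e i) (v ⊕ x) xor (g (v ⊕ x) xor g ((v ⊕ x) ⊕ e i))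
      ≡⟨ cong₂ (λ b u → b xor (g (v ⊕ x) xor g u)) (β-⊕ʳ (e i) v x) (⊕-swapʳ v x (e i)) ⟩
    (β (e i) v xor β (e i) x) xor (g (v ⊕ x) xor g (vi ⊕ x))
      ≡⟨ cong₂ (λ u z → (β (e i) v xor β (e i) x) xor (u xor z)) (g-refines v x refl x∈L)
               (trans (g-refines vi x refl x∈L) (cong (λ z → g vi xor (g x xor z)) (β-⊕ˡ v (e i) x))) ⟩
    (β (e i) v xor β (e i) x) xor ((g v xor (g x xor β v x)) xor (g vi xor (g x xor (β v x xor β (e i) x))))
      ≡⟨ cancel (β (e i) v) (β (e i) x) (g v) (g x) (β v x) (g vi) ⟩
    β (e i) v xor (g v xor g vi) ∎
    where
    vi = v ⊕ e i
    cancel : ∀ a b c d f h → (a xor b) xor ((c xor (d xor f)) xor (h xor (d xor (f xor b)))) ≡ a xor (c xor h)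
    cancel = solve-∀ 𝔽₂

  dash-edge : ∀ v i → dash (v ⊕ e i) i ≡ dash v i
  dash-edge v i = begin
    β (e i) (v ⊕ e i) xor (g (v ⊕ e i) xor g ((v ⊕ e i) ⊕ e i))
      ≡⟨ cong₂ (λ b u → b xor (g (v ⊕ e i) xor g u)) (β-⊕ʳ (e i) v (e i)) (⊕-cancelʳ v (e i)) ⟩
    (β (e i) v xor β (e i) (e i)) xor (g (v ⊕ e i) xor g v)
      ≡⟨ cong (λ b → (β (e i) v xor b) xor (g (v ⊕ e i) xor g v)) (β-e-diag i) ⟩
    (β (e i) v xor false) xor (g (v ⊕ e i) xor g v)
      ≡⟨ cong₂ _xor_ (xor-identityʳ (β (e i) v)) (xor-comm (g (v ⊕ e i)) (g v)) ⟩
    β (e i) v xor (g v xor g (v ⊕ e i)) ∎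

  dashing : EdgeFunction L
  dashing = record
    { val       = dash
    ; coset-inv = λ v w i v⊕w∈L →
        trans (sym (dash-shift v (v ⊕ w) i v⊕w∈L)) (cong (λ z → dash z i) (⊕-cancelˡ v w))
    ; edge-inv  = dash-edge
    }

  -- Around a square the g-terms telescope and only β on basis vectors survives.
  dashing-odd : IsOddDashing dashing
  dashing-odd v i j i≢j = begin
    dash v i xor (dash vi j xor (dash vij i xor dash vj j))
      ≡⟨ cong (dash v i xor_) (cong₂ _xor_ step₁ (cong₂ _xor_ step₂ step₃)) ⟩
    (β (e i) v xor (g v xor g vi)) xor
      (((β (e j) v xor β (e j) (e i)) xor (g vi xor g vij)) xor
        ((((β (e i) v xor β (e i) (e i)) xor β (e i) (e j)) xor (g vij xor g vj)) xor
          ((β (e j) v xor β (e j) (e j)) xor (g vj xor g v))))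
      ≡⟨ telescope (β (e i) v) (β (e j) v) (β (e i) (e i)) (β (e j) (e j)) (β (e i) (e j)) (β (e j) (e i))
                   (g v) (g vi) (g vij) (g vj) ⟩
    (β (e i) (e i) xor β (e j) (e j)) xor ω (e i) (e j)
      ≡⟨ cong₂ (λ u z → (u xor z) xor ω (e i) (e j)) (β-e-diag i) (β-e-diag j) ⟩
    ω (e i) (e j)
      ≡⟨ β-e-symmetrization i j i≢j ⟩
    true ∎
    where
    vi  = v ⊕ e i
    vj  = v ⊕ e j
    vij = vi ⊕ e j
    step₁ : dash vi j ≡ (β (e j) v xor β (e j) (e i)) xor (g vi xor g vij)
    step₁ = cong (_xor (g vi xor g vij)) (β-⊕ʳ (e j) v (e i))
    step₂ : dash vij i ≡ ((β (e i) v xor β (e i) (e i)) xor β (e i) (e j)) xor (g vij xor g vj)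
    step₂ = cong₂ (λ b u → b xor (g vij xor g u))
      (trans (β-⊕ʳ (e i) vi (e j)) (cong (_xor β (e i) (e j)) (β-⊕ʳ (e i) v (e i))))
      (trans (⊕-swapʳ vi (e j) (e i)) (cong (_⊕ e j) (⊕-cancelʳ v (e i))))
    step₃ : dash vj j ≡ (β (e j) v xor β (e j) (e j)) xor (g vj xor g v)
    step₃ = cong₂ (λ b u → b xor (g vj xor g u)) (β-⊕ʳ (e j) v (e j)) (⊕-cancelʳ v (e j))
    telescope : ∀ a b p q r s c₀ c₁ c₂ c₃ →
      (a xor (c₀ xor c₁)) xor (((b xor s) xor (c₁ xor c₂)) xor ((((a xor p) xor r) xor (c₂ xor c₃)) xor
        ((b xor q) xor (c₃ xor c₀)))) ≡ (p xor q) xor (r xor s)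
    telescope = solve-∀ 𝔽₂

mainTheorem7 : ∀ (n : ℕ) (L : Code n) →
    (HasOddDashing L → IsDashingCode L) × (IsDashingCode L → HasOddDashing L)
mainTheorem7 n L = oddDashing⇒dashing , dashing⇒oddDashing
  where
  oddDashing⇒dashing : HasOddDashing L → IsDashingCode L
  oddDashing⇒dashing od = alternating⇒dashing L (oddDashing⇒alternating od)

  dashing⇒oddDashing : IsDashingCode L → HasOddDashing L
  dashing⇒oddDashing dc with alternating⇒refinable (mem-⊕ L) (mem-𝟎 L) (dashing⇒alternating L dc)
  ... | g , g-refines = dashing , dashing-odd
    where open TwistedDashing L g g-refines
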